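{- Let $n=p_1^{n_1}\cdots p_r^{n_r}$ with $r\geq 3$, primes $p_1<\cdots<p_r$ and positive integers $n_i$. Let $a\in[r-1]$ with $2\phi\left(\frac{p_1\cdots p_r}{p_a}\right)<\frac{p_1\cdots p_r}{p_a}$. Then: (i) If $n_r\geq 3$, then $\beta_a^{n_a}>\beta_r^{n_r}$. (ii) If $n_r=2$ and $p_r-p_a\geq r-3$, then $\beta_a^{n_a}>\beta_r^{n_r}$.
   Context: $[m]=\{1,\dots,m\}$, $\phi$ is Euler's totient function. For $a\in[r]$ and $s\in[n_a]$, $$\beta_a^s:=\phi(n)+\frac{n}{p_1\cdots p_r}\cdot\frac{1}{p_a^{s-1}}\left[\frac{p_1\cdots p_r}{p_a}+\phi\left(\frac{p_1\cdots p_r}{p_a}\right)(p_a^{s-1}-2)\right].$$ -}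

module Defs where

open import Data.Nat as ℕ using (ℕ; zero; suc; _∸_; _^_)
open import Data.Nat.GCD using (gcd)
open import Data.Nat.DivMod using (_/_)
open import Data.Fin using (Fin)
open import Data.List using (List; length; filter; upTo; map)
open import Relation.Binary.PropositionalEquality using (_≡_)
open import Data.Nat.Properties using (_≟_)
open import Data.Integer as ℤ using (ℤ; +_)
open import Data.Rational as ℚ using (ℚ)

-- Euler's totient: φ m = #{ k ∈ [1..m] : gcd k m = 1 }  (so φ 1 = 1, φ 0 = 0)
φ : ℕ → ℕ
φ m = length (filter (λ k → gcd k m ≟ 1) (map suc (upTo m)))

∏ : (r : ℕ) → (Fin r → ℕ) → ℕ
∏ zero    f = 1
∏ (suc r) f = f Fin.zero ℕ.* ∏ r (λ i → f (Fin.suc i))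

-- natural division, with the convention x ÷ 0 = 0 (only used with nonzero divisors)
_÷ℕ_ : ℕ → ℕ → ℕ
x ÷ℕ zero  = 0
x ÷ℕ suc d = x / suc d

-- rational fraction z / d, with the convention z / 0 = 0 (only used with d ≠ 0)
frac : ℤ → ℕ → ℚ
frac z zero    = ℚ.0ℚ
frac z (suc d) = z ℚ./ suc d

-- Data of n = p_1^{n_1} ⋯ p_r^{n_r}: primes p : Fin r → ℕ, exponents e : Fin r → ℕ
nOf : (r : ℕ) → (Fin r → ℕ) → (Fin r → ℕ) → ℕ
nOf r p e = ∏ r (λ i → p i ^ e i)

radOf : (r : ℕ) → (Fin r → ℕ) → ℕ
radOf r p = ∏ r p

-- β_a^s = φ(n) + (n / (p_1⋯p_r)) · (1 / p_a^{s-1}) ·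
--          [ (p_1⋯p_r)/p_a + φ((p_1⋯p_r)/p_a) · (p_a^{s-1} - 2) ]
β : (r : ℕ) → (p e : Fin r → ℕ) → Fin r → ℕ → ℚ
β r p e a s =
  frac (+ φ n) 1 ℚ.+
  frac (+ (n ÷ℕ P) ℤ.* (+ (P ÷ℕ p a) ℤ.+ + φ (P ÷ℕ p a) ℤ.* (+ (p a ^ (s ∸ 1)) ℤ.- + 2)))
       (p a ^ (s ∸ 1))
  where
    n = nOf r p e
    P = radOf r p

-- Write P = p₁⋯p_r, x = p_a, y = p_r and M = P/(xy). Since the p_i are distinct primes,
-- P/x = yM, P/y = xM, φ(P/x) = (y−1)φ(M) and φ(P/y) = (x−1)φ(M). With X = x^(n_a−1) and
-- Y = y^(n_r−1), clearing denominators turns β_a^(n_a) > β_r^(n_r) into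
--   (P/y + φ(P/y)·Y)·X + 2φ(P/x)·Y < (P/x + φ(P/x)·X)·Y + 2φ(P/y)·X,
-- which follows from the hypothesis 2φ(P/x) < P/x as soon as P/y + φ(P/y)·Y ≤ φ(P/x)·Y + 2φ(P/y),
-- i.e. xM ≤ (y−x)φ(M)Y + 2(x−1)φ(M). The i-th smallest prime is at least i+1, so M ≤ (r−1)φ(M),
-- and it remains to show x(r−1) ≤ (y−x)Y + 2(x−1). For n_r ≥ 3 this holds because Y ≥ y² and
-- y ≥ r+1; for n_r = 2 because y − x ≥ r − 3 and y − x ≥ 2 (the only primes at distance 1 are 2
-- and 3, while y ≥ r+1 ≥ 4).

module Submission where

open import Defs
import Algebra.Properties.CommutativeMonoid.Sum as CommutativeMonoidSum
open import Data.Bool using (Bool; true; false; _∧_; not; if_then_else_)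
open import Data.Bool.Properties using (∧-identityʳ; ∧-zeroʳ)
open import Data.Nat
  using (ℕ; zero; suc; _+_; _*_; _∸_; _^_; _≤_; _<_; z≤n; s≤s; s≤s⁻¹; z<s; s<s;
         NonZero; >-nonZero; >-nonZero⁻¹; nonTrivial⇒n>1)
open import Data.Nat.Properties
open import Data.Nat.Coprimality using (Coprime; coprime?; coprime-+; coprime-divisor)
open import Data.Nat.DivMod using (m*n/n≡m; m≥n⇒m/n>0)
open import Data.Nat.Divisibility
  using (_∣_; _∣?_; divides; ∣-refl; ∣-trans; ∣-reflexive; ∣m∣n⇒∣m+n; ∣m+n∣m⇒∣n; m∣m*n; n∣m*n; ∣⇒≤; ∣1⇒≡1)
open import Data.Nat.GCD using (gcd)
open import Data.Nat.Primality
  using (Prime; prime⇒nonZero; prime⇒nonTrivial; prime⇒irreducible; euclidsLemma; ¬prime[0]; ¬prime[1])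
open import Data.Nat.Tactic.RingSolver using (solve-∀)
open import Data.Fin using (Fin; toℕ; inject₁; fromℕ; punchIn)
import Data.Fin as Fin
import Data.Fin.Properties as Finₚ
open import Data.Integer as ℤ using (ℤ; +_; +<+)
import Data.Integer.Properties as ℤₚ
import Data.Integer.Tactic.RingSolver as ℤ-Solver
open import Data.Rational as ℚ using (ℚ; _>_)
import Data.Rational.Properties as ℚₚ
import Data.Rational.Unnormalised as ℚᵘ
import Data.Rational.Unnormalised.Properties as ℚᵘₚ
open import Data.List using (length; filter; map; upTo; _++_; [_])
open import Data.List.Properties using (upTo-∷ʳ; map-++; length-++; filter-++)
open import Data.Product using (_×_; _,_)
open import Data.Sum using (_⊎_; inj₁; inj₂)
open import Function using (_∘_; _∘′_; _⇔_; mk⇔)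
open import Function.Definitions using (Injective)
open import Relation.Nullary using (¬_; does; ¬?; _×-dec_)
open import Relation.Nullary.Decidable using (does-⇔; dec-true; dec-false)
open import Relation.Nullary.Negation using (contradiction)
open import Relation.Unary using (Pred; Decidable)
open import Relation.Binary.Definitions using (tri<; tri≈; tri>)
open import Relation.Binary.PropositionalEquality
  using (_≡_; _≢_; refl; sym; trans; cong; cong₂; subst; subst₂; module ≡-Reasoning)

-- Counting and Euler's totient

count : (ℕ → Bool) → ℕ → ℕ
count f zero    = 0
count f (suc n) = count f n + (if f (suc n) then 1 else 0)

length-filter≡count : ∀ {ℓ} {P : Pred ℕ ℓ} (P? : Decidable P) n →
  length (filter P? (map suc (upTo n))) ≡ count (λ i → does (P? i)) n
length-filter≡count P? zero    = refl
length-filter≡count P? (suc n) = begin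
  length (filter P? (map suc (upTo (suc n))))
    ≡⟨ cong (λ is → length (filter P? (map suc is))) (upTo-∷ʳ n) ⟨
  length (filter P? (map suc (upTo n ++ [ n ])))
    ≡⟨ cong (length ∘′ filter P?) (map-++ suc (upTo n) [ n ]) ⟩
  length (filter P? (map suc (upTo n) ++ [ suc n ]))
    ≡⟨ cong length (filter-++ P? (map suc (upTo n)) [ suc n ]) ⟩
  length (filter P? (map suc (upTo n)) ++ filter P? [ suc n ])
    ≡⟨ length-++ (filter P? (map suc (upTo n))) ⟩
  length (filter P? (map suc (upTo n))) + length (filter P? [ suc n ])
    ≡⟨ cong₂ _+_ (length-filter≡count P? n) length-filter-singleton ⟩
  count (λ i → does (P? i)) (suc n) ∎
  where
  open ≡-Reasoning
  length-filter-singleton : length (filter P? [ suc n ]) ≡ (if does (P? (suc n)) then 1 else 0)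
  length-filter-singleton with does (P? (suc n))
  ... | true  = refl
  ... | false = refl

count-cong : ∀ {f g} n → (∀ i → f i ≡ g i) → count f n ≡ count g n
count-cong zero    f≗g = refl
count-cong (suc n) f≗g = cong₂ (λ c b → c + (if b then 1 else 0)) (count-cong n f≗g) (f≗g (suc n))

count-+ : ∀ (f : ℕ → Bool) m n → count f (m + n) ≡ count f m + count (λ i → f (m + i)) n
count-+ f m zero    = trans (cong (count f) (+-identityʳ m)) (sym (+-identityʳ _))
count-+ f m (suc n) rewrite +-suc m n | count-+ f m n =
  +-assoc (count f m) (count (λ i → f (m + i)) n) _

count-∧-split : ∀ (f g : ℕ → Bool) n → count f n ≡ count (λ i → f i ∧ g i) n + count (λ i → f i ∧ not (g i)) n
count-∧-split f g zero    = refl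
count-∧-split f g (suc n) rewrite count-∧-split f g n =
  split (f (suc n)) (g (suc n)) (count (λ i → f i ∧ g i) n) (count (λ i → f i ∧ not (g i)) n)
  where
  split : ∀ b c A B → A + B + (if b then 1 else 0) ≡
                      (A + (if b ∧ c then 1 else 0)) + (B + (if b ∧ not c then 1 else 0))
  split true  true  = solve-∀
  split true  false = solve-∀
  split false c     = solve-∀

count-periodic : ∀ (f : ℕ → Bool) m → (∀ i → f (m + i) ≡ f i) → ∀ c → count f (c * m) ≡ c * count f m
count-periodic f m periodic zero    = refl
count-periodic f m periodic (suc c) = begin
  count f (m + c * m)                           ≡⟨ count-+ f m (c * m) ⟩
  count f m + count (λ i → f (m + i)) (c * m)   ≡⟨ cong (_+_ (count f m)) (count-cong (c * m) periodic) ⟩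
  count f m + count f (c * m)                   ≡⟨ cong (_+_ (count f m)) (count-periodic f m periodic c) ⟩
  count f m + c * count f m                     ∎
  where open ≡-Reasoning

count-vanishes : ∀ (f : ℕ → Bool) n → (∀ i → 1 ≤ i → i ≤ n → f i ≡ false) → count f n ≡ 0
count-vanishes f zero    _ = refl
count-vanishes f (suc n) f≡false
  rewrite count-vanishes f n (λ i 1≤i i≤n → f≡false i 1≤i (m≤n⇒m≤1+n i≤n))
        | f≡false (suc n) (s≤s z≤n) ≤-refl = refl

count-last : ∀ (f : ℕ → Bool) n .{{_ : NonZero n}} → (∀ i → 1 ≤ i → i < n → f i ≡ false) →
             count f n ≡ (if f n then 1 else 0)
count-last f (suc n) f≡false =
  cong (_+ (if f (suc n) then 1 else 0)) (count-vanishes f n (λ i 1≤i i≤n → f≡false i 1≤i (s≤s i≤n)))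

module _ (p : ℕ) .{{_ : NonZero p}} where

  multipleOf : ℕ → Bool
  multipleOf i = does (p ∣? i)

  count-first-multiple : ∀ (f : ℕ → Bool) → count (λ i → f i ∧ multipleOf i) p ≡ (if f p then 1 else 0)
  count-first-multiple f = trans (count-last (λ i → f i ∧ multipleOf i) p below) (cong (λ b → if b then 1 else 0) p-counts)
    where
    below : ∀ i → 1 ≤ i → i < p → f i ∧ multipleOf i ≡ false
    below i 1≤i i<p rewrite dec-false (p ∣? i) (λ p∣i → <⇒≱ i<p (∣⇒≤ {{>-nonZero 1≤i}} p∣i)) = ∧-zeroʳ (f i)
    p-counts : f p ∧ multipleOf p ≡ f p
    p-counts rewrite dec-true (p ∣? p) ∣-refl = ∧-identityʳ (f p)

  count-multiples : ∀ (f : ℕ → Bool) m → count (λ i → f i ∧ multipleOf i) (m * p) ≡ count (λ j → f (j * p)) m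
  count-multiples f zero    = refl
  count-multiples f (suc m) = begin
    count h (p + m * p)                                ≡⟨ count-+ h p (m * p) ⟩
    count h p + count (λ i → h (p + i)) (m * p)        ≡⟨ cong₂ _+_ (count-first-multiple f) (count-cong (m * p) shift) ⟩
    (if f p then 1 else 0) + count (λ i → f (p + i) ∧ multipleOf i) (m * p)
      ≡⟨ cong (_+_ (if f p then 1 else 0)) (count-multiples (λ i → f (p + i)) m) ⟩
    (if f p then 1 else 0) + count (λ j → f (p + j * p)) m
      ≡⟨ cong (λ q → (if f q then 1 else 0) + count (λ j → f (p + j * p)) m) (+-identityʳ p) ⟨
    count (λ j → f (j * p)) 1 + count (λ j → f (p + j * p)) m
      ≡⟨ count-+ (λ j → f (j * p)) 1 m ⟨
    count (λ j → f (j * p)) (suc m) ∎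
    where
    open ≡-Reasoning
    h : ℕ → Bool
    h i = f i ∧ multipleOf i
    shift : ∀ i → h (p + i) ≡ f (p + i) ∧ multipleOf i
    shift i = cong (f (p + i) ∧_)
      (does-⇔ (mk⇔ (λ d → ∣m+n∣m⇒∣n d ∣-refl) (∣m∣n⇒∣m+n ∣-refl)) (p ∣? (p + i)) (p ∣? i))

coprime-∣ˡ : ∀ {d m n} → d ∣ m → Coprime m n → Coprime d n
coprime-∣ˡ d∣m coprime (c∣d , c∣n) = coprime (∣-trans c∣d d∣m , c∣n)

coprime-∣ʳ : ∀ {d m n} → d ∣ n → Coprime m n → Coprime m d
coprime-∣ʳ d∣n coprime (c∣m , c∣d) = coprime (c∣m , ∣-trans c∣d d∣n)

prime∤⇒coprime : ∀ {p n} → Prime p → ¬ p ∣ n → Coprime n p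
prime∤⇒coprime p-prime p∤n (c∣n , c∣p) with prime⇒irreducible p-prime c∣p
... | inj₁ c≡1 = c≡1
... | inj₂ refl = contradiction c∣n p∤n

coprime-+⇔ : ∀ {m i} → Coprime (m + i) m ⇔ Coprime i m
coprime-+⇔ {m} {i} = mk⇔ to coprime-+
  where
  to : Coprime (m + i) m → Coprime i m
  to coprime (d∣i , d∣m) = coprime (∣m∣n⇒∣m+n d∣m d∣i , d∣m)

coprime-prime*⇔ : ∀ {p m i} → Prime p → Coprime i (p * m) ⇔ (Coprime i m × ¬ p ∣ i)
coprime-prime*⇔ {p} {m} {i} p-prime = mk⇔ to from
  where
  to : Coprime i (p * m) → Coprime i m × ¬ p ∣ i
  to coprime = coprime-∣ʳ (n∣m*n p) coprime ,
               λ p∣i → ¬prime[1] (subst Prime (coprime (p∣i , m∣m*n m)) p-prime)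
  from : Coprime i m × ¬ p ∣ i → Coprime i (p * m)
  from (coprime , p∤i) (d∣i , d∣pm) =
    coprime (d∣i , coprime-divisor (coprime-∣ˡ d∣i (prime∤⇒coprime p-prime p∤i)) d∣pm)

coprime-*prime⇔ : ∀ {p m j} → Prime p → ¬ p ∣ m → Coprime (j * p) m ⇔ Coprime j m
coprime-*prime⇔ {p} {m} {j} p-prime p∤m = mk⇔ (coprime-∣ˡ (m∣m*n p)) from
  where
  from : Coprime j m → Coprime (j * p) m
  from coprime (d∣jp , d∣m) = coprime
    (coprime-divisor (coprime-∣ˡ d∣m (prime∤⇒coprime p-prime p∤m)) (∣-trans d∣jp (∣-reflexive (*-comm j p))) , d∣m)

coprimeTo : ℕ → ℕ → Bool
coprimeTo m i = does (coprime? i m)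

-- coprime? i m is gcd i m ≟ 1 with its proofs mapped, so this is φ m unfolded.
φ≡count : ∀ m → φ m ≡ count (coprimeTo m) m
φ≡count m = length-filter≡count (λ i → gcd i m ≟ 1) m

-- Split 1 … p·m by divisibility by p: the integers coprime to m that p divides are the j·p with
-- j ≤ m coprime to m, and those p does not divide are exactly the integers coprime to p·m.
φ[p*m]+φ[m]≡p*φ[m] : ∀ {p m} → Prime p → ¬ p ∣ m → φ (p * m) + φ m ≡ p * φ m
φ[p*m]+φ[m]≡p*φ[m] {p} {m} p-prime p∤m = begin
  φ (p * m) + φ m                                       ≡⟨ cong₂ _+_ φ[p*m]≡ φ[m]≡ ⟩
  count coprime∧∤ (p * m) + count coprime∧∣ (p * m)     ≡⟨ +-comm (count coprime∧∤ (p * m)) _ ⟩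
  count coprime∧∣ (p * m) + count coprime∧∤ (p * m)     ≡⟨ count-∧-split c (multipleOf p) (p * m) ⟨
  count c (p * m)                                       ≡⟨ count-periodic c m periodic p ⟩
  p * count c m                                         ≡⟨ cong (p *_) (φ≡count m) ⟨
  p * φ m                                               ∎
  where
  open ≡-Reasoning
  instance _ = prime⇒nonZero p-prime
  c = coprimeTo m
  coprime∧∣ coprime∧∤ : ℕ → Bool
  coprime∧∣ i = c i ∧ multipleOf p i
  coprime∧∤ i = c i ∧ not (multipleOf p i)
  periodic : ∀ i → c (m + i) ≡ c i
  periodic i = does-⇔ coprime-+⇔ (coprime? (m + i) m) (coprime? i m)
  φ[p*m]≡ : φ (p * m) ≡ count coprime∧∤ (p * m)
  φ[p*m]≡ = trans (φ≡count (p * m)) (count-cong (p * m) λ i →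
    does-⇔ (coprime-prime*⇔ p-prime) (coprime? i (p * m)) (coprime? i m ×-dec ¬? (p ∣? i)))
  φ[m]≡ : φ m ≡ count coprime∧∣ (p * m)
  φ[m]≡ = begin
    φ m                               ≡⟨ φ≡count m ⟩
    count c m
      ≡⟨ count-cong m (λ j → does-⇔ (coprime-*prime⇔ p-prime p∤m) (coprime? (j * p) m) (coprime? j m)) ⟨
    count (λ j → c (j * p)) m         ≡⟨ count-multiples p c m ⟨
    count coprime∧∣ (m * p)           ≡⟨ cong (count coprime∧∣) (*-comm m p) ⟩
    count coprime∧∣ (p * m)           ∎

φ-prime* : ∀ {p m} → Prime p → ¬ p ∣ m → φ (p * m) ≡ (p ∸ 1) * φ m
φ-prime* {zero}   zero-prime _   = contradiction zero-prime ¬prime[0]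
φ-prime* {suc p} {m} p-prime p∤m =
  +-cancelʳ-≡ (φ m) _ _ (trans (φ[p*m]+φ[m]≡p*φ[m] p-prime p∤m) (+-comm (φ m) (p * φ m)))

-- Finite products and increasing families of primes

module Products = CommutativeMonoidSum *-1-commutativeMonoid

∏≡product : ∀ n (f : Fin n → ℕ) → ∏ n f ≡ Products.sum f
∏≡product zero    f = refl
∏≡product (suc n) f = cong (f Fin.zero *_) (∏≡product n (f ∘ Fin.suc))

∏-punchIn : ∀ n (f : Fin (suc n) → ℕ) i → ∏ (suc n) f ≡ f i * ∏ n (f ∘ punchIn i)
∏-punchIn n f i = begin
  ∏ (suc n) f                         ≡⟨ ∏≡product (suc n) f ⟩
  Products.sum f                      ≡⟨ Products.sum-remove f ⟩
  f i * Products.sum (f ∘ punchIn i)  ≡⟨ cong (f i *_) (∏≡product n (f ∘ punchIn i)) ⟨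
  f i * ∏ n (f ∘ punchIn i)           ∎
  where open ≡-Reasoning

∏-cong : ∀ n {f g : Fin n → ℕ} → (∀ i → f i ≡ g i) → ∏ n f ≡ ∏ n g
∏-cong zero    f≗g = refl
∏-cong (suc n) f≗g = cong₂ _*_ (f≗g Fin.zero) (∏-cong n (f≗g ∘ Fin.suc))

∏-mono-≤ : ∀ n {f g : Fin n → ℕ} → (∀ i → f i ≤ g i) → ∏ n f ≤ ∏ n g
∏-mono-≤ zero    f≤g = ≤-refl
∏-mono-≤ (suc n) f≤g = *-mono-≤ (f≤g Fin.zero) (∏-mono-≤ n (f≤g ∘ Fin.suc))

∏-positive : ∀ n (f : Fin n → ℕ) → (∀ i → 1 ≤ f i) → 1 ≤ ∏ n f
∏-positive zero    f f≥1 = ≤-refl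
∏-positive (suc n) f f≥1 = *-mono-≤ (f≥1 Fin.zero) (∏-positive n (f ∘ Fin.suc) (f≥1 ∘ Fin.suc))

prime∤∏primes : ∀ n {q} (f : Fin n → ℕ) → Prime q → (∀ j → Prime (f j)) → (∀ j → q ≢ f j) → ¬ q ∣ ∏ n f
prime∤∏primes zero    f q-prime _       _    q∣1 = ¬prime[1] (subst Prime (∣1⇒≡1 q∣1) q-prime)
prime∤∏primes (suc n) f q-prime f-prime q≢f q∣∏
  with euclidsLemma (f Fin.zero) (∏ n (f ∘ Fin.suc)) q-prime q∣∏
... | inj₂ q∣rest = prime∤∏primes n (f ∘ Fin.suc) q-prime (f-prime ∘ Fin.suc) (q≢f ∘ Fin.suc) q∣rest
... | inj₁ q∣f₀ with prime⇒irreducible (f-prime Fin.zero) q∣f₀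
...   | inj₁ refl = ¬prime[1] q-prime
...   | inj₂ q≡f₀ = q≢f Fin.zero q≡f₀

φ-∏primes : ∀ n (f : Fin n → ℕ) → (∀ j → Prime (f j)) → Injective _≡_ _≡_ f →
            φ (∏ n f) ≡ ∏ n (λ j → f j ∸ 1)
φ-∏primes zero    f f-prime f-injective = refl
φ-∏primes (suc n) f f-prime f-injective = trans
  (φ-prime* (f-prime Fin.zero)
     (prime∤∏primes n (f ∘ Fin.suc) (f-prime Fin.zero) (f-prime ∘ Fin.suc) (λ j → Finₚ.0≢1+n ∘ f-injective)))
  (cong ((f Fin.zero ∸ 1) *_)
     (φ-∏primes n (f ∘ Fin.suc) (f-prime ∘ Fin.suc) (Finₚ.suc-injective ∘ f-injective)))

-- The j-th factor has q/(q − 1) ≤ (j+d+2)/(j+d+1), and these bounds telescope to (n+d+1)/(d+1).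
∏-≤-∏∸1 : ∀ n d (q : Fin n → ℕ) → (∀ j → toℕ j + suc (suc d) ≤ q j) →
          suc d * ∏ n q ≤ (n + suc d) * ∏ n (λ j → q j ∸ 1)
∏-≤-∏∸1 zero    d q q≥ = ≤-refl
∏-≤-∏∸1 (suc n) d q q≥ = begin
  suc d * (q₀ * R)                     ≡⟨ *-assoc (suc d) q₀ R ⟨
  suc d * q₀ * R                       ≤⟨ *-monoˡ-≤ R head-bound ⟩
  suc (suc d) * (q₀ ∸ 1) * R           ≡⟨ swap (suc (suc d)) (q₀ ∸ 1) R ⟩
  (q₀ ∸ 1) * (suc (suc d) * R)         ≤⟨ *-monoʳ-≤ (q₀ ∸ 1) tail-bound ⟩
  (q₀ ∸ 1) * ((n + suc (suc d)) * R′)  ≡⟨ regroup (q₀ ∸ 1) n d R′ ⟩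
  (suc n + suc d) * ((q₀ ∸ 1) * R′)    ∎
  where
  open ≤-Reasoning
  q₀ = q Fin.zero
  R  = ∏ n (q ∘ Fin.suc)
  R′ = ∏ n (λ j → q (Fin.suc j) ∸ 1)
  tail-bound : suc (suc d) * R ≤ (n + suc (suc d)) * R′
  tail-bound = ∏-≤-∏∸1 n (suc d) (q ∘ Fin.suc)
    (λ j → subst (_≤ q (Fin.suc j)) (sym (+-suc (toℕ j) (suc (suc d)))) (q≥ (Fin.suc j)))
  swap : ∀ a b c → a * b * c ≡ b * (a * c)
  swap = solve-∀
  regroup : ∀ a n d r → a * ((n + suc (suc d)) * r) ≡ (suc n + suc d) * (a * r)
  regroup = solve-∀
  head-bound : suc d * q₀ ≤ suc (suc d) * (q₀ ∸ 1)
  head-bound = pred-bound q₀ (q≥ Fin.zero)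
    where
    pred-bound : ∀ m → suc (suc d) ≤ m → suc d * m ≤ suc (suc d) * (m ∸ 1)
    pred-bound (suc u) (s≤s d<u) = begin
      suc d * suc u      ≡⟨ *-suc (suc d) u ⟩
      suc d + suc d * u  ≤⟨ +-monoˡ-≤ (suc d * u) d<u ⟩
      u + suc d * u      ∎

Increasing : ∀ {n} → (Fin n → ℕ) → Set
Increasing f = ∀ i j → i Fin.< j → f i < f j

increasing⇒injective : ∀ {n} {f : Fin n → ℕ} → Increasing f → Injective _≡_ _≡_ f
increasing⇒injective {f = f} increasing {i} {j} fi≡fj with Finₚ.<-cmp i j
... | tri< i<j _ _ = contradiction fi≡fj (<⇒≢ (increasing i j i<j))
... | tri≈ _ i≡j _ = i≡j
... | tri> _ _ j<i = contradiction (sym fi≡fj) (<⇒≢ (increasing j i j<i))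

increasing⇒≥ : ∀ {n m} (f : Fin n → ℕ) → (∀ i → m ≤ f i) → Increasing f → ∀ i → toℕ i + m ≤ f i
increasing⇒≥ f f≥m increasing Fin.zero = f≥m Fin.zero
increasing⇒≥ {m = m} f f≥m increasing (Fin.suc i) = subst (_≤ f (Fin.suc i)) (+-suc (toℕ i) m)
  (increasing⇒≥ (f ∘ Fin.suc) (λ j → ≤-<-trans (f≥m Fin.zero) (increasing Fin.zero (Fin.suc j) z<s))
     (λ j k j<k → increasing (Fin.suc j) (Fin.suc k) (s<s j<k)) i)

toℕ≤toℕ-punchIn : ∀ {n} (i : Fin (suc n)) (j : Fin n) → toℕ j ≤ toℕ (punchIn i j)
toℕ≤toℕ-punchIn Fin.zero    j           = n≤1+n (toℕ j)
toℕ≤toℕ-punchIn (Fin.suc i) Fin.zero    = z≤n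
toℕ≤toℕ-punchIn (Fin.suc i) (Fin.suc j) = s≤s (toℕ≤toℕ-punchIn i j)

2∣n⊎2∣1+n : ∀ n → 2 ∣ n ⊎ 2 ∣ suc n
2∣n⊎2∣1+n zero    = inj₁ (divides 0 refl)
2∣n⊎2∣1+n (suc n) with 2∣n⊎2∣1+n n
... | inj₁ 2∣n   = inj₂ (∣m∣n⇒∣m+n ∣-refl 2∣n)
... | inj₂ 2∣1+n = inj₁ 2∣1+n

consecutive-primes : ∀ {p} → Prime p → Prime (suc p) → p ≡ 2
consecutive-primes {p} p-prime 1+p-prime with 2∣n⊎2∣1+n p
... | inj₁ 2∣p with prime⇒irreducible p-prime 2∣p
...   | inj₁ ()
...   | inj₂ 2≡p = sym 2≡p
consecutive-primes {p} p-prime 1+p-prime | inj₂ 2∣1+p with prime⇒irreducible 1+p-prime 2∣1+p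
...   | inj₁ ()
...   | inj₂ refl = contradiction p-prime ¬prime[1]

primes-gap : ∀ {p q} → Prime p → Prime q → p < q → 4 ≤ q → 2 ≤ q ∸ p
primes-gap {p} {q} p-prime q-prime p<q 4≤q = m+n≤o⇒m≤o∸n 2 (≤∧≢⇒< p<q 1+p≢q)
  where
  1+p≢q : suc p ≢ q
  1+p≢q refl with consecutive-primes p-prime q-prime
  ... | refl = contradiction 4≤q (<⇒≱ (n<1+n 3))

-- Arithmetic estimates

weighted-gap : ∀ Qa fa Qr fr X Y → 1 ≤ Y → 2 * fa < Qa → Qr + fr * Y ≤ fa * Y + 2 * fr →
               (Qr + fr * Y) * X + 2 * fa * Y < (Qa + fa * X) * Y + 2 * fr * X
weighted-gap Qa fa Qr fr X Y Y≥1 2fa<Qa Qr-small = begin-strict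
  (Qr + fr * Y) * X + 2 * fa * Y      ≤⟨ +-monoˡ-≤ (2 * fa * Y) (*-monoˡ-≤ X Qr-small) ⟩
  (fa * Y + 2 * fr) * X + 2 * fa * Y  ≡⟨ +-comm ((fa * Y + 2 * fr) * X) (2 * fa * Y) ⟩
  2 * fa * Y + (fa * Y + 2 * fr) * X  <⟨ +-monoˡ-< ((fa * Y + 2 * fr) * X) (*-monoˡ-< Y ⦃ >-nonZero Y≥1 ⦄ 2fa<Qa) ⟩
  Qa * Y + (fa * Y + 2 * fr) * X      ≡⟨ regroup Qa fa fr X Y ⟩
  (Qa + fa * X) * Y + 2 * fr * X      ∎
  where
  open ≤-Reasoning
  regroup : ∀ Qa fa fr X Y → Qa * Y + (fa * Y + 2 * fr) * X ≡ (Qa + fa * X) * Y + 2 * fr * X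
  regroup = solve-∀

m∸n+[n∸o]≡m∸o : ∀ {m n o} → o ≤ n → n ≤ m → (m ∸ n) + (n ∸ o) ≡ m ∸ o
m∸n+[n∸o]≡m∸o {m} {n} {o} o≤n n≤m = trans (sym (+-∸-assoc (m ∸ n) o≤n)) (cong (_∸ o) (m∸n+n≡m n≤m))

cofactor-bound : ∀ {x y K M f Y} → 1 ≤ x → x ≤ y → M ≤ K * f → x * K ≤ (y ∸ x) * Y + 2 * (x ∸ 1) →
                 x * M + (x ∸ 1) * f * Y ≤ (y ∸ 1) * f * Y + 2 * ((x ∸ 1) * f)
cofactor-bound {x} {y} {K} {M} {f} {Y} 1≤x x≤y M≤Kf xK-bound = begin
  x * M + (x ∸ 1) * f * Y                   ≤⟨ +-monoˡ-≤ ((x ∸ 1) * f * Y) (*-monoʳ-≤ x M≤Kf) ⟩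
  x * (K * f) + (x ∸ 1) * f * Y             ≡⟨ cong (_+ (x ∸ 1) * f * Y) (*-assoc x K f) ⟨
  x * K * f + (x ∸ 1) * f * Y               ≤⟨ +-monoˡ-≤ ((x ∸ 1) * f * Y) (*-monoˡ-≤ f xK-bound) ⟩
  ((y ∸ x) * Y + 2 * (x ∸ 1)) * f + (x ∸ 1) * f * Y ≡⟨ regroup (y ∸ x) (x ∸ 1) f Y ⟩
  ((y ∸ x) + (x ∸ 1)) * f * Y + 2 * ((x ∸ 1) * f) ≡⟨ cong (λ c → c * f * Y + 2 * ((x ∸ 1) * f)) (m∸n+[n∸o]≡m∸o 1≤x x≤y) ⟩
  (y ∸ 1) * f * Y + 2 * ((x ∸ 1) * f)       ∎
  where
  open ≤-Reasoning
  regroup : ∀ a b f Y → (a * Y + 2 * b) * f + b * f * Y ≡ (a + b) * f * Y + 2 * (b * f)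
  regroup = solve-∀

gap-bound-large-power : ∀ {x y K Y} → x < y → K + 2 ≤ y → y ^ 2 ≤ Y → x * K ≤ (y ∸ x) * Y + 2 * (x ∸ 1)
gap-bound-large-power {x} {y} {K} {Y} x<y K+2≤y y²≤Y = begin
  x * K                       ≤⟨ *-mono-≤ (<⇒≤ x<y) (≤-trans (m≤m+n K 2) K+2≤y) ⟩
  y * y                       ≡⟨ cong (y *_) (*-identityʳ y) ⟨
  y ^ 2                       ≤⟨ y²≤Y ⟩
  Y                           ≤⟨ m≤n*m Y (y ∸ x) ⦃ >-nonZero (m<n⇒0<n∸m x<y) ⦄ ⟩
  (y ∸ x) * Y                 ≤⟨ m≤m+n ((y ∸ x) * Y) (2 * (x ∸ 1)) ⟩
  (y ∸ x) * Y + 2 * (x ∸ 1)   ∎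
  where open ≤-Reasoning

gap-bound-square : ∀ {x y K} → x ≤ y → 2 ≤ y ∸ x → K ≤ 2 + (y ∸ x) → x * K ≤ (y ∸ x) * y + 2 * (x ∸ 1)
gap-bound-square {zero}          _   _    _      = z≤n
gap-bound-square {suc u} {y} {K} x≤y 2≤δ K≤2+δ = begin
  suc u * K                   ≤⟨ *-monoʳ-≤ (suc u) K≤2+δ ⟩
  suc u * (2 + δ)             ≡⟨ expand u δ ⟩
  δ * suc u + 2 * u + 2       ≤⟨ +-monoʳ-≤ (δ * suc u + 2 * u) 2≤δ² ⟩
  δ * suc u + 2 * u + δ * δ   ≡⟨ collect u δ ⟩
  δ * (suc u + δ) + 2 * u     ≡⟨ cong (λ z → δ * z + 2 * u) (m+[n∸m]≡n x≤y) ⟩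
  δ * y + 2 * u               ∎
  where
  open ≤-Reasoning
  δ = y ∸ suc u
  2≤δ² : 2 ≤ δ * δ
  2≤δ² = ≤-trans 2≤δ (m≤m*n δ δ ⦃ >-nonZero (≤-trans (s≤s z≤n) 2≤δ) ⦄)
  expand : ∀ u δ → suc u * (2 + δ) ≡ δ * suc u + 2 * u + 2
  expand = solve-∀
  collect : ∀ u δ → δ * suc u + 2 * u + δ * δ ≡ δ * (suc u + δ) + 2 * u
  collect = solve-∀

-- Comparing the rational terms of β

frac-< : ∀ {z₁ z₂ d₁ d₂} → 1 ≤ d₁ → 1 ≤ d₂ → z₁ ℤ.* + d₂ ℤ.< z₂ ℤ.* + d₁ → frac z₁ d₁ ℚ.< frac z₂ d₂
frac-< {z₁} {z₂} {suc d₁} {suc d₂} _ _ z₁d₂<z₂d₁ = ℚₚ.toℚᵘ-cancel-<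
  (ℚᵘₚ.<-respʳ-≃ (ℚᵘₚ.≃-sym (ℚₚ.toℚᵘ-fromℚᵘ (ℚᵘ.mkℚᵘ z₂ d₂)))
  (ℚᵘₚ.<-respˡ-≃ (ℚᵘₚ.≃-sym (ℚₚ.toℚᵘ-fromℚᵘ (ℚᵘ.mkℚᵘ z₁ d₁)))
  (ℚᵘ.*<* z₁d₂<z₂d₁)))

-- β r p e i s unfolds to frac (+ φ n) 1 ℚ.+ βterm (n ÷ℕ P) (P ÷ℕ p i) (φ (P ÷ℕ p i)) (p i ^ (s ∸ 1)).
βterm : ℕ → ℕ → ℕ → ℕ → ℚ
βterm N Q f X = frac (+ N ℤ.* (+ Q ℤ.+ + f ℤ.* (+ X ℤ.- + 2))) X

+-weighted : ∀ Q f X Y g → + ((Q + f * X) * Y + 2 * g * X) ≡ (+ Q ℤ.+ + f ℤ.* + X) ℤ.* + Y ℤ.+ + 2 ℤ.* + g ℤ.* + X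
+-weighted Q f X Y g = begin
  + ((Q + f * X) * Y + 2 * g * X)                  ≡⟨ ℤₚ.pos-+ ((Q + f * X) * Y) (2 * g * X) ⟩
  + ((Q + f * X) * Y) ℤ.+ + (2 * g * X)            ≡⟨ cong₂ ℤ._+_ (ℤₚ.pos-* (Q + f * X) Y) (ℤₚ.pos-* (2 * g) X) ⟩
  + (Q + f * X) ℤ.* + Y ℤ.+ + (2 * g) ℤ.* + X      ≡⟨ cong₂ (λ a b → a ℤ.* + Y ℤ.+ b ℤ.* + X)
                                                         (trans (ℤₚ.pos-+ Q (f * X)) (cong (ℤ._+_ (+ Q)) (ℤₚ.pos-* f X)))
                                                         (ℤₚ.pos-* 2 g) ⟩
  (+ Q ℤ.+ + f ℤ.* + X) ℤ.* + Y ℤ.+ + 2 ℤ.* + g ℤ.* + X ∎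
  where open ≡-Reasoning

βterm-< : ∀ N Qa fa X Qr fr Y → 1 ≤ N → 1 ≤ X → 1 ≤ Y →
          (Qr + fr * Y) * X + 2 * fa * Y < (Qa + fa * X) * Y + 2 * fr * X →
          βterm N Qr fr Y ℚ.< βterm N Qa fa X
βterm-< (suc N) Qa fa X Qr fr Y _ 1≤X 1≤Y gap = frac-< 1≤Y 1≤X (begin-strict
  + suc N ℤ.* Tr ℤ.* + X      ≡⟨ ℤₚ.*-assoc (+ suc N) Tr (+ X) ⟩
  + suc N ℤ.* (Tr ℤ.* + X)    <⟨ ℤₚ.*-monoˡ-<-pos (+ suc N) cross-multiplied ⟩
  + suc N ℤ.* (Ta ℤ.* + Y)    ≡⟨ ℤₚ.*-assoc (+ suc N) Ta (+ Y) ⟨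
  + suc N ℤ.* Ta ℤ.* + Y      ∎)
  where
  open ℤₚ.≤-Reasoning
  Tr Ta S : ℤ
  Tr = + Qr ℤ.+ + fr ℤ.* (+ Y ℤ.- + 2)
  Ta = + Qa ℤ.+ + fa ℤ.* (+ X ℤ.- + 2)
  S  = + 2 ℤ.* + fa ℤ.* + Y ℤ.+ + 2 ℤ.* + fr ℤ.* + X
  shiftʳ : ∀ Qr fr Y X fa → (Qr ℤ.+ fr ℤ.* (Y ℤ.- + 2)) ℤ.* X ≡
           ((Qr ℤ.+ fr ℤ.* Y) ℤ.* X ℤ.+ + 2 ℤ.* fa ℤ.* Y) ℤ.- (+ 2 ℤ.* fa ℤ.* Y ℤ.+ + 2 ℤ.* fr ℤ.* X)
  shiftʳ = ℤ-Solver.solve-∀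
  shiftᵃ : ∀ Qa fa X Y fr → (Qa ℤ.+ fa ℤ.* (X ℤ.- + 2)) ℤ.* Y ≡
           ((Qa ℤ.+ fa ℤ.* X) ℤ.* Y ℤ.+ + 2 ℤ.* fr ℤ.* X) ℤ.- (+ 2 ℤ.* fa ℤ.* Y ℤ.+ + 2 ℤ.* fr ℤ.* X)
  shiftᵃ = ℤ-Solver.solve-∀
  cross-multiplied : Tr ℤ.* + X ℤ.< Ta ℤ.* + Y
  cross-multiplied = begin-strict
    Tr ℤ.* + X                                    ≡⟨ shiftʳ (+ Qr) (+ fr) (+ Y) (+ X) (+ fa) ⟩
    ((+ Qr ℤ.+ + fr ℤ.* + Y) ℤ.* + X ℤ.+ + 2 ℤ.* + fa ℤ.* + Y) ℤ.- S
                                                  ≡⟨ cong (ℤ._- S) (+-weighted Qr fr Y X fa) ⟨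
    + ((Qr + fr * Y) * X + 2 * fa * Y) ℤ.- S      <⟨ ℤₚ.+-monoˡ-< (ℤ.- S) (+<+ gap) ⟩
    + ((Qa + fa * X) * Y + 2 * fr * X) ℤ.- S      ≡⟨ cong (ℤ._- S) (+-weighted Qa fa X Y fr) ⟩
    ((+ Qa ℤ.+ + fa ℤ.* + X) ℤ.* + Y ℤ.+ + 2 ℤ.* + fr ℤ.* + X) ℤ.- S
                                                  ≡⟨ shiftᵃ (+ Qa) (+ fa) (+ X) (+ Y) (+ fr) ⟨
    Ta ℤ.* + Y                                    ∎

-- The radical with p_a and p_r removed

m*n÷ℕn≡m : ∀ m n .{{_ : NonZero n}} → (m * n) ÷ℕ n ≡ m
m*n÷ℕn≡m m (suc n) = m*n/n≡m m (suc n)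

÷ℕ-positive : ∀ {m n} .{{_ : NonZero n}} → n ≤ m → 1 ≤ m ÷ℕ n
÷ℕ-positive {n = suc n} n≤m = m≥n⇒m/n>0 n≤m

punchIn-fromℕ : ∀ n (j : Fin n) → punchIn (fromℕ n) j ≡ inject₁ j
punchIn-fromℕ (suc n) Fin.zero    = refl
punchIn-fromℕ (suc n) (Fin.suc j) = cong Fin.suc (punchIn-fromℕ n j)

module Splitting {k : ℕ} (p : Fin (2 + k) → ℕ) (prime : ∀ i → Prime (p i)) (increasing : Increasing p)
                 (a : Fin (suc k)) where

  -- the primes p_i with i ∉ {a, r}
  others : Fin k → ℕ
  others j = p (inject₁ (punchIn a j))

  x y M P : ℕ
  x = p (inject₁ a)
  y = p (fromℕ (suc k))
  M = ∏ k others
  P = radOf (2 + k) p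

  p-injective : Injective _≡_ _≡_ p
  p-injective = increasing⇒injective increasing

  p≥ : ∀ i → toℕ i + 2 ≤ p i
  p≥ = increasing⇒≥ p (λ i → nonTrivial⇒n>1 (p i) ⦃ prime⇒nonTrivial (prime i) ⦄) increasing

  x≥1 : 1 ≤ x
  x≥1 = >-nonZero⁻¹ x ⦃ prime⇒nonZero (prime _) ⦄

  x<y : x < y
  x<y = increasing (inject₁ a) (fromℕ (suc k))
    (subst (toℕ (inject₁ a) <_) (sym (Finₚ.toℕ-fromℕ (suc k))) (Finₚ.inject₁ℕ< a))

  y≥ : suc k + 2 ≤ y
  y≥ = subst (λ m → m + 2 ≤ y) (Finₚ.toℕ-fromℕ (suc k)) (p≥ (fromℕ (suc k)))

  P≡y*[x*M] : P ≡ y * (x * M)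
  P≡y*[x*M] = begin
    ∏ (2 + k) p                                  ≡⟨ ∏-punchIn (suc k) p (fromℕ (suc k)) ⟩
    y * ∏ (suc k) (p ∘ punchIn (fromℕ (suc k)))  ≡⟨ cong (y *_) (∏-cong (suc k) (cong p ∘ punchIn-fromℕ (suc k))) ⟩
    y * ∏ (suc k) (p ∘ inject₁)                  ≡⟨ cong (y *_) (∏-punchIn k (p ∘ inject₁) a) ⟩
    y * (x * M)                                  ∎
    where open ≡-Reasoning

  P÷x≡y*M : P ÷ℕ x ≡ y * M
  P÷x≡y*M = trans (cong (_÷ℕ x) (trans P≡y*[x*M] (rearrange y x M))) (m*n÷ℕn≡m (y * M) x ⦃ prime⇒nonZero (prime _) ⦄)
    where
    rearrange : ∀ y x M → y * (x * M) ≡ y * M * x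
    rearrange = solve-∀

  P÷y≡x*M : P ÷ℕ y ≡ x * M
  P÷y≡x*M = trans (cong (_÷ℕ y) (trans P≡y*[x*M] (*-comm y (x * M)))) (m*n÷ℕn≡m (x * M) y ⦃ prime⇒nonZero (prime _) ⦄)

  others-prime : ∀ j → Prime (others j)
  others-prime j = prime (inject₁ (punchIn a j))

  x∤M : ¬ x ∣ M
  x∤M = prime∤∏primes k others (prime _) others-prime
    (λ j → Finₚ.punchInᵢ≢i a j ∘ sym ∘ Finₚ.inject₁-injective ∘ p-injective)

  y∤M : ¬ y ∣ M
  y∤M = prime∤∏primes k others (prime _) others-prime (λ j → Finₚ.fromℕ≢inject₁ ∘ p-injective)

  φ[P÷x] : φ (P ÷ℕ x) ≡ (y ∸ 1) * φ M
  φ[P÷x] = trans (cong φ P÷x≡y*M) (φ-prime* (prime _) y∤M)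

  φ[P÷y] : φ (P ÷ℕ y) ≡ (x ∸ 1) * φ M
  φ[P÷y] = trans (cong φ P÷y≡x*M) (φ-prime* (prime _) x∤M)

  M≤[1+k]*φM : M ≤ suc k * φ M
  M≤[1+k]*φM = subst₂ _≤_ (*-identityˡ M) (cong₂ _*_ (+-comm k 1) (sym φM≡)) (∏-≤-∏∸1 k 0 others others≥)
    where
    φM≡ : φ M ≡ ∏ k (λ j → others j ∸ 1)
    φM≡ = φ-∏primes k others others-prime
      (Finₚ.punchIn-injective a _ _ ∘ Finₚ.inject₁-injective ∘ p-injective)
    others≥ : ∀ j → toℕ j + 2 ≤ others j
    others≥ j = ≤-trans
      (+-monoˡ-≤ 2 (subst (toℕ j ≤_) (sym (Finₚ.toℕ-inject₁ (punchIn a j))) (toℕ≤toℕ-punchIn a j)))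
      (p≥ (inject₁ (punchIn a j)))

  module _ (e : Fin (2 + k) → ℕ) where

    t : ℕ
    t = e (fromℕ (suc k))

    y²≤y^[t∸1] : 3 ≤ t → y ^ 2 ≤ y ^ (t ∸ 1)
    y²≤y^[t∸1] 3≤t = ^-monoʳ-≤ y ⦃ prime⇒nonZero (prime _) ⦄ (m+n≤o⇒m≤o∸n 2 3≤t)

    y^[t∸1]≡y : t ≡ 2 → y ^ (t ∸ 1) ≡ y
    y^[t∸1]≡y t≡2 = trans (cong (λ t → y ^ (t ∸ 1)) t≡2) (*-identityʳ y)

    β-comparison : (∀ i → 1 ≤ e i) → 2 * φ (P ÷ℕ x) < P ÷ℕ x →
                   x * suc k ≤ (y ∸ x) * y ^ (t ∸ 1) + 2 * (x ∸ 1) →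
                   β (2 + k) p e (inject₁ a) (e (inject₁ a)) > β (2 + k) p e (fromℕ (suc k)) t
    β-comparison e≥1 2φ<Q bound = ℚₚ.+-monoʳ-< (frac (+ φ (nOf (2 + k) p e)) 1)
      (βterm-< N (P ÷ℕ x) (φ (P ÷ℕ x)) X (P ÷ℕ y) (φ (P ÷ℕ y)) Y N≥1 X≥1 Y≥1
        (weighted-gap (P ÷ℕ x) (φ (P ÷ℕ x)) (P ÷ℕ y) (φ (P ÷ℕ y)) X Y Y≥1 2φ<Q cofactor-small))
      where
      N X Y : ℕ
      N = nOf (2 + k) p e ÷ℕ P
      X = x ^ (e (inject₁ a) ∸ 1)
      Y = y ^ (t ∸ 1)
      X≥1 : 1 ≤ X
      X≥1 = m^n>0 x ⦃ prime⇒nonZero (prime _) ⦄ (e (inject₁ a) ∸ 1)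
      Y≥1 : 1 ≤ Y
      Y≥1 = m^n>0 y ⦃ prime⇒nonZero (prime _) ⦄ (t ∸ 1)
      N≥1 : 1 ≤ N
      N≥1 = ÷ℕ-positive ⦃ >-nonZero (∏-positive (2 + k) p (λ i → >-nonZero⁻¹ (p i) ⦃ prime⇒nonZero (prime i) ⦄)) ⦄
        (∏-mono-≤ (2 + k) λ i →
           subst (_≤ p i ^ e i) (*-identityʳ (p i)) (^-monoʳ-≤ (p i) ⦃ prime⇒nonZero (prime i) ⦄ (e≥1 i)))
      cofactor-small : P ÷ℕ y + φ (P ÷ℕ y) * Y ≤ φ (P ÷ℕ x) * Y + 2 * φ (P ÷ℕ y)
      cofactor-small = begin
        P ÷ℕ y + φ (P ÷ℕ y) * Y                ≡⟨ cong₂ (λ Q f → Q + f * Y) P÷y≡x*M φ[P÷y] ⟩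
        x * M + (x ∸ 1) * φ M * Y              ≤⟨ cofactor-bound x≥1 (<⇒≤ x<y) M≤[1+k]*φM bound ⟩
        (y ∸ 1) * φ M * Y + 2 * ((x ∸ 1) * φ M) ≡⟨ cong₂ (λ f g → f * Y + 2 * g) φ[P÷x] φ[P÷y] ⟨
        φ (P ÷ℕ x) * Y + 2 * φ (P ÷ℕ y)        ∎
        where open ≤-Reasoning

corollary3p7 : (k : ℕ) → 3 ≤ suc k →
    (p e : Fin (suc k) → ℕ) →
    (∀ i → Prime (p i)) →
    (∀ i j → Data.Fin._<_ i j → p i < p j) →
    (∀ i → 1 ≤ e i) →
    (a : Fin k) →
    2 * φ (radOf (suc k) p ÷ℕ p (inject₁ a)) < radOf (suc k) p ÷ℕ p (inject₁ a) →
    ((3 ≤ e (fromℕ k) →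
        β (suc k) p e (inject₁ a) (e (inject₁ a)) > β (suc k) p e (fromℕ k) (e (fromℕ k)))
    × (e (fromℕ k) ≡ 2 → suc k ∸ 3 ≤ p (fromℕ k) ∸ p (inject₁ a) →
        β (suc k) p e (inject₁ a) (e (inject₁ a)) > β (suc k) p e (fromℕ k) (e (fromℕ k))))
corollary3p7 zero    _   _ _ _     _          _   ()
corollary3p7 (suc k) 3≤r p e prime increasing e≥1 a 2φ<Q =
    (λ 3≤t → β-comparison e e≥1 2φ<Q (gap-bound-large-power x<y y≥ (y²≤y^[t∸1] e 3≤t)))
  , (λ t≡2 r∸3≤y∸x → β-comparison e e≥1 2φ<Q
       (subst (λ Y → x * suc k ≤ (y ∸ x) * Y + 2 * (x ∸ 1)) (sym (y^[t∸1]≡y e t≡2))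
         (gap-bound-square (<⇒≤ x<y) (primes-gap (prime _) (prime _) x<y 4≤y)
           (≤-trans (s≤s (m≤n+m∸n k 1)) (+-monoʳ-≤ 2 r∸3≤y∸x)))))
  where
  open Splitting p prime increasing a
  4≤y : 4 ≤ y
  4≤y = ≤-trans (+-monoˡ-≤ 2 (s≤s⁻¹ 3≤r)) y≥
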